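{- Let $\alpha=(a_n)_{n\ge1}$ be a parking preference of infinite length. Then $\alpha$ is an $\infty$-Naples parking function if and only if every maximal interval of $U_\alpha$ is finite.
   Context: A parking preference of infinite length is a sequence $\alpha=(a_n)_{n\ge1}$ of positive integers. Countably many cars $c_1,c_2,\dots$ arrive in order at a one-way street with spots $1,2,3,\dots$; car $c_j$ has preference $a_j$. Under the $\infty$-Naples parking rule, car $c_j$ drives to spot $a_j$ and parks there if free; otherwise it checks spots $a_j-1,a_j-2,\dots,1$ in this order and parks in the first free one; if none is free it drives forward and parks in the first free spot $>a_j$ (which always exists). $\alpha$ is an $\infty$-Naples parking function if every spot is eventually occupied. For $j\ge1$ let $|\alpha|_i=|\{m:a_m=i\}|$ and $u_\alpha(j)=j-1-\sum_{i=1}^{j-1}|\alpha|_i$ (if some $|\alpha|_i$ with $i<j$ is infinite, $u_\alpha(j)=-\infty$), and $U_\alpha=\{j\ge1:u_\alpha(j)\ge1\}$. A maximal interval of $U_\alpha$ is a set of consecutive integers $[p,q]\subseteq U_\alpha$ (where $q=\infty$ is allowed, meaning all integers $\ge p$) not strictly contained in another such interval in $U_\alpha$. -}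

module Defs where

open import Data.Nat using (ℕ; zero; suc; _+_; _≤_; _≡ᵇ_)
open import Data.Bool using (Bool; true; false; if_then_else_)
open import Data.List using (List; []; _∷_; length)
open import Data.Bool.ListAction using (any)
open import Data.Maybe using (Maybe; just; nothing)
open import Data.Product using (Σ; ∃; _×_; _,_)
open import Relation.Binary.PropositionalEquality using (_≡_)

-- A parking preference of infinite length: α : ℕ → ℕ, where α n is the
-- preference of car c_(n+1) (cars are 0-indexed here, spots are 1,2,3,...).
-- Positivity of the preferences is a separate hypothesis in the theorem.
Preference : Set
Preference = ℕ → ℕ

occupied? : List ℕ → ℕ → Bool
occupied? occ s = any (λ x → x ≡ᵇ s) occ

backSearch : List ℕ → ℕ → Maybe ℕ
backSearch occ zero    = nothing
backSearch occ (suc k) = if occupied? occ (suc k) then backSearch occ k else just (suc k)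

-- forward search: first free spot among s, s+1, ... ; the fuel argument
-- is large enough (length occ + 1) that the fallback is never reached,
-- since among length occ + 1 consecutive spots one is free.
fwdSearch : List ℕ → ℕ → ℕ → ℕ
fwdSearch occ s zero     = s
fwdSearch occ s (suc f)  = if occupied? occ s then fwdSearch occ (suc s) f else s

park : List ℕ → ℕ → ℕ
park occ a with backSearch occ a
... | just s  = s
... | nothing = fwdSearch occ (suc a) (suc (length occ))

mutual
  occupiedAfter : Preference → ℕ → List ℕ
  occupiedAfter α zero    = []
  occupiedAfter α (suc n) = spotOf α n ∷ occupiedAfter α n

  spotOf : Preference → ℕ → ℕ
  spotOf α n = park (occupiedAfter α n) (α n)

IsInfNaplesPF : Preference → Set
IsInfNaplesPF α = ∀ s → 1 ≤ s → ∃ λ n → spotOf α n ≡ s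

countPrefix : Preference → ℕ → ℕ → ℕ
countPrefix α zero    i = 0
countPrefix α (suc M) i = (if α M ≡ᵇ i then 1 else 0) + countPrefix α M i

-- |α|_i = k  (in particular |α|_i is finite): the set {m : a_m = i} has
-- exactly k elements, i.e. the prefix counts eventually equal k.
Card : Preference → ℕ → ℕ → Set
Card α i k = ∃ λ N → ∀ M → N ≤ M → countPrefix α M i ≡ k

-- SumCard α j s : all |α|_i with 1 ≤ i < j are finite and Σ_{i=1}^{j-1} |α|_i = s
data SumCard (α : Preference) : ℕ → ℕ → Set where
  base : SumCard α 1 0
  step : ∀ {j s k} → SumCard α j s → Card α j k → SumCard α (suc j) (s + k)

-- j ∈ U_α  :⇔  j ≥ 1 and u_α(j) = j - 1 - Σ_{i<j}|α|_i ≥ 1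
-- (u_α(j) = -∞ when some |α|_i, i<j, is infinite, so then j ∉ U_α).
InU : Preference → ℕ → Set
InU α j = 1 ≤ j × (∃ λ s → SumCard α j s × (1 + s + 1 ≤ j))

data ℕ∞ : Set where
  fin : ℕ → ℕ∞
  ∞   : ℕ∞

data _≤∞_ : ℕ∞ → ℕ∞ → Set where
  fin≤fin : ∀ {m n} → m ≤ n → fin m ≤∞ fin n
  _≤∞∞    : ∀ x → x ≤∞ ∞

_∈[_,_] : ℕ → ℕ → ℕ∞ → Set
j ∈[ p , q ] = p ≤ j × fin j ≤∞ q

IsIntervalIn : Preference → ℕ → ℕ∞ → Set
IsIntervalIn α p q = 1 ≤ p × fin p ≤∞ q × (∀ j → j ∈[ p , q ] → InU α j)

IsMaximalInterval : Preference → ℕ → ℕ∞ → Set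
IsMaximalInterval α p q =
  IsIntervalIn α p q ×
  (∀ p' q' → IsIntervalIn α p' q' → p' ≤ p → q ≤∞ q' → (p' ≡ p × q' ≡ q))

{-# OPTIONS --safe #-}
-- Let L_j(M) be the number of cars among the first M whose preference is below j;
-- Σ_{i<j} |α|_i is the eventual value of L_j(M).
--
-- If every spot gets occupied but U_α contains all j ≥ p, wait until the spots
-- 1, ..., p are occupied and let g be the first free spot.  Each of the spots
-- 1, ..., g - 1 is occupied by a car preferring a spot below g, so g - 1 ≤ L_g ≤
-- Σ_{i<g} |α|_i, contradicting u_α(g) ≥ 1.
--
-- If spot s is never occupied, then for j > s the cars preferring a spot below j
-- park, at distinct spots, among 1, ..., j - 1 other than s, so L_j(M) ≤ j - 2 for
-- all M.  Hence (classically) every |α|_i is finite and u_α(j) ≥ 1 for all j > s,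
-- and the tail of U_α from its least possible left end is an infinite maximal interval.

module Submission where

open import Defs
open import Level using (0ℓ)
open import Axiom.ExcludedMiddle using (ExcludedMiddle)
open import Data.Nat using (ℕ; _≤_)
open import Function.Bundles using (_⇔_)
open import Relation.Binary.PropositionalEquality using (_≢_)

open import Data.Bool using (Bool; true; false; if_then_else_)
open import Data.List using (List; []; _∷_; length; map; filter; applyUpTo; downFrom)
open import Data.List.Membership.Propositional using (_∈_; _∉_; _─_)
open import Data.List.Membership.Propositional.Properties
  using (∈-map⁺; ∈-map⁻; ∈-filter⁺; ∈-filter⁻; ∈-downFrom⁺; ∈-downFrom⁻; ∈-applyUpTo⁺; ∈-applyUpTo⁻)
open import Data.List.Properties using (length-map; length-applyUpTo; length-removeAt′; filter-none)
open import Data.List.Relation.Binary.Subset.Propositional using (_⊆_)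
open import Data.List.Relation.Unary.All as All using (All)
open import Data.List.Relation.Unary.All.Properties using (applyDownFrom⁺₂)
open import Data.List.Relation.Unary.Any as Any using (here; there; index)
open import Data.List.Relation.Unary.Any.Properties using (any⁺; any⁻)
open import Data.List.Relation.Unary.Unique.Propositional using (Unique)
open import Data.List.Relation.Unary.Unique.Propositional.Properties
  using (map⁺; filter⁺; downFrom⁺; applyUpTo⁺₁)
open import Data.List.Relation.Unary.AllPairs using (_∷_)
open import Data.Empty using (⊥-elim)
open import Data.Maybe using (just; nothing)
open import Data.Nat using (zero; suc; _+_; _<_; _⊔_; _≤′_; ≤′-refl; ≤′-step; _<ᵇ_; _≡ᵇ_; z≤n; s≤s)
open import Data.Nat.Induction using (<-rec)
open import Data.Nat.Properties
open import Algebra.Properties.CommutativeSemigroup +-commutativeSemigroup using (interchange)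
open import Data.Product using (∃; _×_; _,_; proj₁; proj₂)
open import Data.Sum using (_⊎_; inj₁; inj₂)
open import Function using (_∘_)
open import Function.Bundles using (mk⇔)
open import Relation.Binary.PropositionalEquality using (_≡_; refl; sym; trans; cong; cong₂; subst; module ≡-Reasoning)
open import Relation.Binary.Definitions using (tri<; tri≈; tri>)
open import Relation.Nullary using (¬_; yes; no; contradiction)
open import Relation.Nullary.Reflects using (Reflects; ofʸ; ofⁿ; fromEquivalence)

module _ {a} {A : Set a} where

  ∈-─ : ∀ {x y} {ys : List A} (x∈ys : x ∈ ys) → y ∈ ys → y ≢ x → y ∈ ys ─ x∈ys
  ∈-─ (here refl) (here refl) y≢x = contradiction refl y≢x
  ∈-─ (here refl) (there y∈ys) _  = y∈ys
  ∈-─ (there _)   (here refl)  _  = here refl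
  ∈-─ (there x∈ys) (there y∈ys) y≢x = there (∈-─ x∈ys y∈ys y≢x)

  unique-⊆⇒length≤ : ∀ {xs ys : List A} → Unique xs → xs ⊆ ys → length xs ≤ length ys
  unique-⊆⇒length≤ {[]} _ _ = z≤n
  unique-⊆⇒length≤ {x ∷ xs} {ys} (x≢xs ∷ xs-unique) x∷xs⊆ys = begin
    suc (length xs)          ≤⟨ s≤s (unique-⊆⇒length≤ xs-unique xs⊆ys─x) ⟩
    suc (length (ys ─ x∈ys)) ≡⟨ length-removeAt′ ys (index x∈ys) ⟨
    length ys                ∎
    where
    open ≤-Reasoning
    x∈ys = x∷xs⊆ys (here refl)
    xs⊆ys─x : xs ⊆ ys ─ x∈ys
    xs⊆ys─x y∈xs = ∈-─ x∈ys (x∷xs⊆ys (there y∈xs)) (All.lookup x≢xs y∈xs ∘ sym)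

stepwise⇒monotone : (f : ℕ → ℕ) → (∀ n → f n ≤ f (suc n)) → ∀ {m n} → m ≤ n → f m ≤ f n
stepwise⇒monotone f grows m≤n = go (≤⇒≤′ m≤n)
  where
  go : ∀ {m n} → m ≤′ n → f m ≤ f n
  go ≤′-refl        = ≤-refl
  go (≤′-step m≤′n) = ≤-trans (go m≤′n) (grows _)

indicator : Bool → ℕ
indicator b = if b then 1 else 0

indicator-<ᵇ-suc : ∀ a j → indicator (a <ᵇ suc j) ≡ indicator (a <ᵇ j) + indicator (a ≡ᵇ j)
indicator-<ᵇ-suc zero    zero    = refl
indicator-<ᵇ-suc zero    (suc j) = refl
indicator-<ᵇ-suc (suc a) zero    = refl
indicator-<ᵇ-suc (suc a) (suc j) = indicator-<ᵇ-suc a j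

IsLeast : (ℕ → Set) → ℕ → Set
IsLeast P m = P m × (∀ {k} → k < m → ¬ P k)

module _ (em : ExcludedMiddle 0ℓ) where

  least-witness : (P : ℕ → Set) → ∀ {n} → P n → ∃ (IsLeast P)
  least-witness P {n} = <-rec (λ n → P n → ∃ (IsLeast P)) search n
    where
    search : ∀ n → (∀ {k} → k < n → P k → ∃ (IsLeast P)) → P n → ∃ (IsLeast P)
    search n below pn with em {∃ λ k → k < n × P k}
    ... | yes (k , k<n , pk) = below k<n pk
    ... | no none            = n , pn , λ k<n pk → none (_ , k<n , pk)

  least-upper-bound-attained : (f : ℕ → ℕ) → ∀ {L} → IsLeast (λ b → ∀ n → f n ≤ b) L → ∃ λ N → L ≤ f N
  least-upper-bound-attained f {zero}  _           = 0 , z≤n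
  least-upper-bound-attained f {suc L} (_ , least) with em {∃ λ N → L < f N}
  ... | yes above = above
  ... | no none   = contradiction (λ n → ≮⇒≥ (λ L<fn → none (n , L<fn))) (least ≤-refl)

  monotone-bounded⇒stable : (f : ℕ → ℕ) → (∀ n → f n ≤ f (suc n)) → ∀ {B} → (∀ n → f n ≤ B) →
                            ∃ λ N → ∀ M → N ≤ M → f M ≡ f N
  monotone-bounded⇒stable f grows bounded
    with L , lub@(f≤L , _) ← least-witness (λ b → ∀ n → f n ≤ b) bounded
    with N , L≤fN ← least-upper-bound-attained f lub
    = N , λ M N≤M → ≤-antisym (≤-trans (f≤L M) L≤fN) (stepwise⇒monotone f grows N≤M)

spots : ℕ → List ℕ
spots n = applyUpTo suc n

∈-spots⁺ : ∀ {n y} → 1 ≤ y → y ≤ n → y ∈ spots n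
∈-spots⁺ {y = suc y} _ y<n = ∈-applyUpTo⁺ suc y<n

∈-spots⁻ : ∀ {n y} → y ∈ spots n → 1 ≤ y × y ≤ n
∈-spots⁻ y∈ with _ , i<n , refl ← ∈-applyUpTo⁻ suc y∈ = s≤s z≤n , i<n

spots-unique : ∀ n → Unique (spots n)
spots-unique n = applyUpTo⁺₁ suc n (λ i<j _ → <⇒≢ i<j ∘ suc-injective)

spots⊈ : ∀ {n} {occ : List ℕ} → length occ < n → ¬ (spots n ⊆ occ)
spots⊈ {n} {occ} short spots⊆occ =
  <⇒≱ short (subst (_≤ length occ) (length-applyUpTo suc n) (unique-⊆⇒length≤ (spots-unique n) spots⊆occ))

occupied?-reflects : ∀ occ s → Reflects (s ∈ occ) (occupied? occ s)
occupied?-reflects occ s = fromEquivalence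
  (Any.map (sym ∘ ≡ᵇ⇒≡ _ _) ∘ any⁻ _ occ)
  (any⁺ _ ∘ Any.map (≡⇒≡ᵇ _ _ ∘ sym))

backSearch-just : ∀ occ a {x} → backSearch occ a ≡ just x → 1 ≤ x × x ≤ a × x ∉ occ
backSearch-just occ (suc k) found with occupied? occ (suc k) | occupied?-reflects occ (suc k)
... | true  | _ with 1≤x , x≤k , x∉occ ← backSearch-just occ k found = 1≤x , m≤n⇒m≤1+n x≤k , x∉occ
... | false | ofⁿ k∉occ with refl ← found = s≤s z≤n , ≤-refl , k∉occ

backSearch-finds : ∀ occ a {y} → 1 ≤ y → y ≤ a → y ∉ occ → ∃ λ x → backSearch occ a ≡ just x × y ≤ x
backSearch-finds occ zero    1≤y y≤0 _ = contradiction (≤-trans 1≤y y≤0) λ ()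
backSearch-finds occ (suc k) 1≤y y≤a y∉occ with occupied? occ (suc k) | occupied?-reflects occ (suc k)
... | false | _ = suc k , refl , y≤a
... | true  | ofʸ k∈occ with m≤n⇒m<n∨m≡n y≤a
...   | inj₁ y<a  = backSearch-finds occ k 1≤y (≤-pred y<a) y∉occ
...   | inj₂ refl = contradiction k∈occ y∉occ

backSearch-nothing : ∀ occ a → backSearch occ a ≡ nothing → ∀ {y} → 1 ≤ y → y ≤ a → y ∈ occ
backSearch-nothing occ a none {y} 1≤y y≤a with occupied? occ y | occupied?-reflects occ y
... | true  | ofʸ y∈occ = y∈occ
... | false | ofⁿ y∉occ with _ , found , _ ← backSearch-finds occ a 1≤y y≤a y∉occ
  with () ← trans (sym none) found

fwdSearch-≥ : ∀ occ st f → st ≤ fwdSearch occ st f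
fwdSearch-≥ occ st zero = ≤-refl
fwdSearch-≥ occ st (suc f) with occupied? occ st
... | true  = ≤-trans (n≤1+n st) (fwdSearch-≥ occ (suc st) f)
... | false = ≤-refl

fwdSearch-≤-free : ∀ occ st f {y} → st ≤ y → y ∉ occ → fwdSearch occ st f ≤ y
fwdSearch-≤-free occ st zero    st≤y _ = st≤y
fwdSearch-≤-free occ st (suc f) st≤y y∉occ with occupied? occ st | occupied?-reflects occ st
... | false | _ = st≤y
... | true  | ofʸ st∈occ with m≤n⇒m<n∨m≡n st≤y
...   | inj₁ st<y = fwdSearch-≤-free occ (suc st) f st<y y∉occ
...   | inj₂ refl = contradiction st∈occ y∉occ

fwdSearch-skips : ∀ occ st f {z} → st ≤ z → z < fwdSearch occ st f → z ∈ occ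
fwdSearch-skips occ st zero    st≤z z<st = contradiction z<st (≤⇒≯ st≤z)
fwdSearch-skips occ st (suc f) st≤z z<fs with occupied? occ st | occupied?-reflects occ st
... | false | _ = contradiction z<fs (≤⇒≯ st≤z)
... | true  | ofʸ st∈occ with m≤n⇒m<n∨m≡n st≤z
...   | inj₁ st<z = fwdSearch-skips occ (suc st) f st<z z<fs
...   | inj₂ refl = st∈occ

fwdSearch-free-or-exhausted : ∀ occ st f → fwdSearch occ st f ∉ occ ⊎ fwdSearch occ st f ≡ st + f
fwdSearch-free-or-exhausted occ st zero = inj₂ (sym (+-identityʳ st))
fwdSearch-free-or-exhausted occ st (suc f) with occupied? occ st | occupied?-reflects occ st
... | false | ofⁿ st∉occ = inj₁ st∉occ
... | true  | _ with fwdSearch-free-or-exhausted occ (suc st) f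
...   | inj₁ free      = inj₁ free
...   | inj₂ exhausted = inj₂ (trans exhausted (sym (+-suc st f)))

-- The fuel of the forward search suffices: a list of L spots cannot cover 1, ..., L + 1.
park-∉ : ∀ occ a → park occ a ∉ occ
park-∉ occ a with backSearch occ a in found
... | just x  = proj₂ (proj₂ (backSearch-just occ a found))
... | nothing with fwdSearch-free-or-exhausted occ (suc a) (suc (length occ))
...   | inj₁ free      = free
...   | inj₂ exhausted = ⊥-elim (spots⊈ ≤-refl covered)
  where
  covered : spots (suc (length occ)) ⊆ occ
  covered y∈ with 1≤y , y≤L+1 ← ∈-spots⁻ y∈ with _ ≤? a
  ... | yes y≤a = backSearch-nothing occ a found 1≤y y≤a
  ... | no  y≰a = fwdSearch-skips occ (suc a) (suc (length occ)) (≰⇒> y≰a)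
                    (subst (_ <_) (sym exhausted) (s≤s (≤-trans y≤L+1 (m≤n+m _ a))))

park-pos : ∀ occ a → 1 ≤ park occ a
park-pos occ a with backSearch occ a in found
... | just x  = proj₁ (backSearch-just occ a found)
... | nothing = ≤-trans (s≤s z≤n) (fwdSearch-≥ occ (suc a) (suc (length occ)))

park-≥-free : ∀ occ a {y} → 1 ≤ y → y ≤ a → y ∉ occ → y ≤ park occ a
park-≥-free occ a 1≤y y≤a y∉occ with backSearch-finds occ a 1≤y y≤a y∉occ
... | x , found , y≤x rewrite found = y≤x

park-≤-free : ∀ occ a {s} → 1 ≤ s → s ∉ occ → park occ a ≤ a ⊔ s
park-≤-free occ a {s} 1≤s s∉occ with backSearch occ a in found
... | just x  = ≤-trans (proj₁ (proj₂ (backSearch-just occ a found))) (m≤m⊔n a s)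
... | nothing = ≤-trans (fwdSearch-≤-free occ (suc a) (suc (length occ)) a<s s∉occ) (m≤n⊔m a s)
  where
  a<s : a < s
  a<s = ≰⇒> (s∉occ ∘ backSearch-nothing occ a found 1≤s)

park-fills-gap : ∀ occ a → (∀ {y} → 1 ≤ y → y ≤ a → y ∈ occ) →
                 ∀ {y} → 1 ≤ y → y < park occ a → y ∈ occ
park-fills-gap occ a filled {y} 1≤y y<park with backSearch occ a in found
... | just x with 1≤x , x≤a , x∉occ ← backSearch-just occ a found = contradiction (filled 1≤x x≤a) x∉occ
... | nothing with y ≤? a
...   | yes y≤a = filled 1≤y y≤a
...   | no  y≰a = fwdSearch-skips occ (suc a) (suc (length occ)) (≰⇒> y≰a) y<park

module _ (α : Preference) where

  occupiedAfter≡map : ∀ n → occupiedAfter α n ≡ map (spotOf α) (downFrom n)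
  occupiedAfter≡map zero    = refl
  occupiedAfter≡map (suc n) = cong (spotOf α n ∷_) (occupiedAfter≡map n)

  ∈-occupiedAfter⁺ : ∀ {m n} → m < n → spotOf α m ∈ occupiedAfter α n
  ∈-occupiedAfter⁺ {n = n} m<n rewrite occupiedAfter≡map n = ∈-map⁺ (spotOf α) (∈-downFrom⁺ m<n)

  ∈-occupiedAfter⁻ : ∀ {n y} → y ∈ occupiedAfter α n → ∃ λ m → m < n × y ≡ spotOf α m
  ∈-occupiedAfter⁻ {n} y∈ rewrite occupiedAfter≡map n with m , m∈ , y≡ ← ∈-map⁻ (spotOf α) y∈ =
    m , ∈-downFrom⁻ m∈ , y≡

  occupiedAfter-mono : ∀ {m n} → m ≤ n → occupiedAfter α m ⊆ occupiedAfter α n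
  occupiedAfter-mono m≤n y∈ with k , k<m , refl ← ∈-occupiedAfter⁻ y∈ = ∈-occupiedAfter⁺ (<-≤-trans k<m m≤n)

  spotOf-∉ : ∀ n → spotOf α n ∉ occupiedAfter α n
  spotOf-∉ n = park-∉ (occupiedAfter α n) (α n)

  spotOf-pos : ∀ n → 1 ≤ spotOf α n
  spotOf-pos n = park-pos (occupiedAfter α n) (α n)

  spotOf-injective : ∀ {m n} → spotOf α m ≡ spotOf α n → m ≡ n
  spotOf-injective {m} {n} eq with <-cmp m n
  ... | tri< m<n _ _ = contradiction (subst (_∈ occupiedAfter α n) eq (∈-occupiedAfter⁺ m<n)) (spotOf-∉ n)
  ... | tri≈ _ m≡n _ = m≡n
  ... | tri> _ _ n<m = contradiction (subst (_∈ occupiedAfter α m) (sym eq) (∈-occupiedAfter⁺ n<m)) (spotOf-∉ m)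

  carsBelow : ℕ → ℕ → List ℕ
  carsBelow j M = filter (λ m → α m <? j) (downFrom M)

  carsBelow-unique : ∀ j M → Unique (carsBelow j M)
  carsBelow-unique j M = filter⁺ (λ m → α m <? j) (downFrom⁺ M)

  ∈-carsBelow⁺ : ∀ {j M m} → m < M → α m < j → m ∈ carsBelow j M
  ∈-carsBelow⁺ {j} m<M αm<j = ∈-filter⁺ (λ m → α m <? j) (∈-downFrom⁺ m<M) αm<j

  ∈-carsBelow⁻ : ∀ {j M m} → m ∈ carsBelow j M → m < M × α m < j
  ∈-carsBelow⁻ {j} m∈ with m∈↓ , αm<j ← ∈-filter⁻ (λ m → α m <? j) m∈ = ∈-downFrom⁻ m∈↓ , αm<j

  length-carsBelow-sucʳ : ∀ j M → length (carsBelow j (suc M)) ≡ indicator (α M <ᵇ j) + length (carsBelow j M)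
  length-carsBelow-sucʳ j M with α M <ᵇ j
  ... | true  = refl
  ... | false = refl

  length-carsBelow-sucˡ : ∀ j M → length (carsBelow (suc j) M) ≡ length (carsBelow j M) + countPrefix α M j
  length-carsBelow-sucˡ j zero    = refl
  length-carsBelow-sucˡ j (suc M) = begin
    length (carsBelow (suc j) (suc M))
      ≡⟨ length-carsBelow-sucʳ (suc j) M ⟩
    indicator (α M <ᵇ suc j) + length (carsBelow (suc j) M)
      ≡⟨ cong₂ _+_ (indicator-<ᵇ-suc (α M) j) (length-carsBelow-sucˡ j M) ⟩
    (indicator (α M <ᵇ j) + indicator (α M ≡ᵇ j)) + (length (carsBelow j M) + countPrefix α M j)
      ≡⟨ interchange (indicator (α M <ᵇ j)) _ _ _ ⟩
    (indicator (α M <ᵇ j) + length (carsBelow j M)) + countPrefix α (suc M) j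
      ≡⟨ cong (_+ countPrefix α (suc M) j) (length-carsBelow-sucʳ j M) ⟨
    length (carsBelow j (suc M)) + countPrefix α (suc M) j
      ∎
    where open ≡-Reasoning

  countPrefix≤length-carsBelow : ∀ {i j} M → i < j → countPrefix α M i ≤ length (carsBelow j M)
  countPrefix≤length-carsBelow {i} {j} M i<j = begin
    countPrefix α M i                                 ≤⟨ m≤n+m _ _ ⟩
    length (carsBelow i M) + countPrefix α M i        ≡⟨ length-carsBelow-sucˡ i M ⟨
    length (carsBelow (suc i) M)                      ≤⟨ stepwise⇒monotone (λ j → length (carsBelow j M)) below-mono i<j ⟩
    length (carsBelow j M)                            ∎
    where
    open ≤-Reasoning
    below-mono : ∀ j → length (carsBelow j M) ≤ length (carsBelow (suc j) M)
    below-mono j = subst (length (carsBelow j M) ≤_) (sym (length-carsBelow-sucˡ j M)) (m≤m+n _ _)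

  length-carsBelow-mono : ∀ j {M M′} → M ≤ M′ → length (carsBelow j M) ≤ length (carsBelow j M′)
  length-carsBelow-mono j {M} M≤M′ = unique-⊆⇒length≤ (carsBelow-unique j M) λ m∈ →
    let m<M , αm<j = ∈-carsBelow⁻ m∈ in ∈-carsBelow⁺ (<-≤-trans m<M M≤M′) αm<j

  -- Preferences are positive, so |α|_0 does not enter the count.
  sumCard⇒length-carsBelow : (∀ n → 1 ≤ α n) → ∀ {j s} → SumCard α j s →
                             ∃ λ N → ∀ M → N ≤ M → length (carsBelow j M) ≡ s
  sumCard⇒length-carsBelow pos base = 0 , λ M _ →
    cong length (filter-none (λ m → α m <? 1) (applyDownFrom⁺₂ (λ m → m) M (λ m → ≤⇒≯ (pos m))))
  sumCard⇒length-carsBelow pos (step {j} sc (N₂ , card)) with N₁ , sum ← sumCard⇒length-carsBelow pos sc =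
    N₁ ⊔ N₂ , λ M N≤M → trans (length-carsBelow-sucˡ j M)
      (cong₂ _+_ (sum M (≤-trans (m≤m⊔n N₁ N₂) N≤M)) (card M (≤-trans (m≤n⊔m N₁ N₂) N≤M)))

  cards⇒sumCard : (∀ i → ∃ (Card α i)) → ∀ j → ∃ (SumCard α (suc j))
  cards⇒sumCard card zero = 0 , base
  cards⇒sumCard card (suc j) with s , sc ← cards⇒sumCard card j | k , c ← card (suc j) = s + k , step sc c

  spots-eventually-occupied : IsInfNaplesPF α → ∀ p → ∃ λ t → spots p ⊆ occupiedAfter α t
  spots-eventually-occupied naples zero = 0 , λ ()
  spots-eventually-occupied naples (suc p)
    with t , filled ← spots-eventually-occupied naples p
    with n , spot≡ ← naples (suc p) (s≤s z≤n)
    = t ⊔ suc n , covered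
    where
    covered : spots (suc p) ⊆ occupiedAfter α (t ⊔ suc n)
    covered y∈ with 1≤y , y≤1+p ← ∈-spots⁻ y∈ with m≤n⇒m<n∨m≡n y≤1+p
    ... | inj₁ y<1+p = occupiedAfter-mono (m≤m⊔n t (suc n)) (filled (∈-spots⁺ 1≤y (≤-pred y<1+p)))
    ... | inj₂ refl  = subst (_∈ occupiedAfter α (t ⊔ suc n)) spot≡ (∈-occupiedAfter⁺ (m≤n⊔m t (suc n)))

  -- Otherwise the backward search from α m ≥ g would have stopped at the free spot g or above it.
  preference-below-free-spot : ∀ {t g m} → m < t → g ∉ occupiedAfter α t → spotOf α m < g → α m < g
  preference-below-free-spot {m = m} m<t g∉occ spot<g = ≰⇒> λ g≤αm →
    <⇒≱ spot<g (park-≥-free (occupiedAfter α m) (α m) 1≤g g≤αm (g∉occ ∘ occupiedAfter-mono (<⇒≤ m<t)))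
    where
    1≤g = ≤-trans (spotOf-pos m) (<⇒≤ spot<g)

  first-free-spot-∉U : (∀ n → 1 ≤ α n) → ∀ t g → 1 ≤ g → (∀ {y} → 1 ≤ y → y < g → y ∈ occupiedAfter α t) →
                       g ∉ occupiedAfter α t → ¬ InU α g
  first-free-spot-∉U pos t (suc g) _ filled g∉occ (_ , s , sc , u≥1)
    with N , count ← sumCard⇒length-carsBelow pos sc
    = <⇒≱ (subst (_≤ g) (+-comm s 1) (≤-pred u≥1)) (begin
      g                                         ≡⟨ length-applyUpTo suc g ⟨
      length (spots g)                          ≤⟨ unique-⊆⇒length≤ (spots-unique g) spots⊆ ⟩
      length (map (spotOf α) (carsBelow (suc g) t)) ≡⟨ length-map (spotOf α) (carsBelow (suc g) t) ⟩
      length (carsBelow (suc g) t)              ≤⟨ length-carsBelow-mono (suc g) (m≤m⊔n t N) ⟩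
      length (carsBelow (suc g) (t ⊔ N))        ≡⟨ count (t ⊔ N) (m≤n⊔m t N) ⟩
      s                                         ∎)
    where
    open ≤-Reasoning
    spots⊆ : spots g ⊆ map (spotOf α) (carsBelow (suc g) t)
    spots⊆ y∈ with 1≤y , y≤g ← ∈-spots⁻ y∈ with m , m<t , refl ← ∈-occupiedAfter⁻ (filled 1≤y (s≤s y≤g)) =
      ∈-map⁺ (spotOf α) (∈-carsBelow⁺ m<t (preference-below-free-spot m<t g∉occ (s≤s y≤g)))

  naples⇒no-tail-in-U : (∀ n → 1 ≤ α n) → IsInfNaplesPF α → ∀ p → ¬ (∀ j → p ≤ j → InU α j)
  naples⇒no-tail-in-U pos naples p tail with t , filled ← spots-eventually-occupied naples p =
    first-free-spot-∉U pos t g (park-pos occ p)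
      (park-fills-gap occ p λ 1≤y y≤p → filled (∈-spots⁺ 1≤y y≤p)) (park-∉ occ p)
      (tail g p≤g)
    where
    occ = occupiedAfter α t
    g = park occ p
    p≤g : p ≤ g
    p≤g = ≮⇒≥ λ g<p → park-∉ occ p (filled (∈-spots⁺ (park-pos occ p) (<⇒≤ g<p)))

  module _ {s} (1≤s : 1 ≤ s) (never : ∀ n → spotOf α n ≢ s) where

    s∉occupiedAfter : ∀ M → s ∉ occupiedAfter α M
    s∉occupiedAfter M s∈ with m , _ , s≡ ← ∈-occupiedAfter⁻ s∈ = never m (sym s≡)

    carsBelow-bound : ∀ {j} → s < j → ∀ M → 2 + length (carsBelow j M) ≤ j
    carsBelow-bound {suc j} s<j M = s≤s (begin
      suc (length (carsBelow (suc j) M))                    ≡⟨ cong suc (length-map (spotOf α) (carsBelow (suc j) M)) ⟨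
      length (s ∷ map (spotOf α) (carsBelow (suc j) M))     ≤⟨ unique-⊆⇒length≤ unique ⊆spots ⟩
      length (spots j)                                      ≡⟨ length-applyUpTo suc j ⟩
      j                                                     ∎)
      where
      open ≤-Reasoning
      unique : Unique (s ∷ map (spotOf α) (carsBelow (suc j) M))
      unique = All.tabulate (λ y∈ → let m , _ , y≡ = ∈-map⁻ (spotOf α) y∈ in λ s≡y → never m (sym (trans s≡y y≡)))
             ∷ map⁺ spotOf-injective (carsBelow-unique (suc j) M)
      ⊆spots : s ∷ map (spotOf α) (carsBelow (suc j) M) ⊆ spots j
      ⊆spots (here refl) = ∈-spots⁺ 1≤s (≤-pred s<j)
      ⊆spots (there y∈) with m , m∈ , refl ← ∈-map⁻ (spotOf α) y∈ with _ , αm<j ← ∈-carsBelow⁻ {suc j} {M} m∈ =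
        ∈-spots⁺ (spotOf-pos m) (≤-pred (≤-<-trans
          (park-≤-free (occupiedAfter α m) (α m) 1≤s (s∉occupiedAfter m)) (⊔-lub αm<j s<j)))

    never⇒card : ExcludedMiddle 0ℓ → ∀ i → ∃ (Card α i)
    never⇒card em i =
      let N , stable = monotone-bounded⇒stable em (λ M → countPrefix α M i) (λ M → m≤n+m _ _) bounded
      in countPrefix α N i , N , stable
      where
      j = suc (i + s)
      bounded : ∀ M → countPrefix α M i ≤ j
      bounded M = ≤-trans (countPrefix≤length-carsBelow M (s≤s (m≤m+n i s)))
                          (≤-trans (m≤n+m _ 2) (carsBelow-bound (s≤s (m≤n+m s i)) M))

    never⇒tail-in-U : ExcludedMiddle 0ℓ → (∀ n → 1 ≤ α n) → ∀ j → s < j → InU α j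
    never⇒tail-in-U em pos (suc j) s<j
      with t , sc ← cards⇒sumCard (never⇒card em) j
      with N , count ← sumCard⇒length-carsBelow pos sc
      = s≤s z≤n , t , sc , subst (_≤ suc j) (trans (cong (2 +_) (count N ≤-refl)) (cong suc (+-comm 1 t)))
                             (carsBelow-bound s<j N)

  tail⇒infinite-maximal-interval : ExcludedMiddle 0ℓ → ∀ {p} → (∀ j → p ≤ j → InU α j) →
                                   ∃ λ q → IsMaximalInterval α q ∞
  tail⇒infinite-maximal-interval em tail
    with q , q-tail , q-least ← least-witness em (λ p → ∀ j → p ≤ j → InU α j) tail
    = q , (proj₁ (q-tail q ≤-refl) , (fin q ≤∞∞) , λ j (q≤j , _) → q-tail j q≤j) , maximal
    where
    maximal : ∀ p′ q′ → IsIntervalIn α p′ q′ → p′ ≤ q → ∞ ≤∞ q′ → p′ ≡ q × q′ ≡ ∞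
    maximal p′ .∞ (_ , _ , p′-tail) p′≤q (.∞ ≤∞∞) with m≤n⇒m<n∨m≡n p′≤q
    ... | inj₁ p′<q = contradiction (λ j p′≤j → p′-tail j (p′≤j , (fin j ≤∞∞))) (q-least p′<q)
    ... | inj₂ p′≡q = p′≡q , refl

mainTheorem9 : ExcludedMiddle 0ℓ →
    (α : Preference) → (∀ n → 1 ≤ α n) →
    IsInfNaplesPF α ⇔ (∀ p q → IsMaximalInterval α p q → q ≢ ∞)
mainTheorem9 em α pos = mk⇔ naples⇒finite finite⇒naples
  where
  naples⇒finite : IsInfNaplesPF α → ∀ p q → IsMaximalInterval α p q → q ≢ ∞
  naples⇒finite naples p .∞ ((_ , _ , inU) , _) refl =
    naples⇒no-tail-in-U α pos naples p λ j p≤j → inU j (p≤j , (fin j ≤∞∞))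

  finite⇒naples : (∀ p q → IsMaximalInterval α p q → q ≢ ∞) → IsInfNaplesPF α
  finite⇒naples finite s 1≤s with em {∃ λ n → spotOf α n ≡ s}
  ... | yes occupied = occupied
  ... | no unoccupied with q , maximal ← tail⇒infinite-maximal-interval α em
                                           (never⇒tail-in-U α 1≤s (λ n eq → unoccupied (n , eq)) em pos)
    = contradiction refl (finite q ∞ maximal)
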